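{- Let $G$ be a graph and let $\alpha\in H_1(G,\mathbb{Z})$ be nonzero. Then $\mathcal{C}_G(\alpha,\Vert\alpha\Vert)$ is nonempty if and only if $\alpha$ is connected.
   Context: A graph is finite, may have loops and multiple edges, and has no isolated vertices. Each edge $e$ gives two oriented edges $\mathbf{e}$ and $\mathbf{e}^{ -1}$; $\mathbf{E}(G)$ is the set of oriented edges, $\mathbf{e}(0),\mathbf{e}(1)$ initial/terminal vertices. An orientation $\mathfrak{o}$ chooses one oriented edge per edge, giving $\mathbf{E}_{\mathfrak{o}}(G)$. A walk of length $l$ is a sequence $\mathbf{a}_1\cdots\mathbf{a}_l$ with $\mathbf{a}_{i+1}(0)=\mathbf{a}_i(1)$; a circuit is a closed walk ($\mathbf{a}_l(1)=\mathbf{a}_1(0)$) with no backtrack ($\mathbf{a}_{i+1}\neq\mathbf{a}_i^{ -1}$) and no tail ($\mathbf{a}_1\neq\mathbf{a}_l^{ -1}$). $C_1(G,\mathbb{Z})$ is the free abelian group on $\mathbf{E}_{\mathfrak{o}}(G)$, with $\mathbf{e}^{ -1}=-\mathbf{e}$. For $\alpha=\sum_{\mathbf{e}\in\mathbf{E}_{\mathfrak{o}}(G)}c_{\mathbf{e}}\mathbf{e}$: $\deg_\alpha(\mathbf{e})=c_{\mathbf{e}}$, $\deg_\alpha(\mathbf{e}^{ -1})=-c_{\mathbf{e}}$, $\deg_\alpha(v)=\sum_{\mathbf{e}\in\mathbf{E}(G),\mathbf{e}(0)=v}\deg_\alpha(\mathbf{e})$; $H_1(G,\mathbb{Z})=\{\alpha:\deg_\alpha(v)=0\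 \forall v\}$. The abelianization of a walk is the sum of its oriented edges in $C_1(G,\mathbb{Z})$. $\Vert\alpha\Vert=\sum_{\mathbf{e}\in\mathbf{E}_{\mathfrak{o}}(G)}|c_{\mathbf{e}}|$. $\mathcal{C}_G(\alpha,l)$ is the set of circuits of length $l$ with abelianization $\alpha$. A nonzero $\alpha$ is uniquely $\sum c_{\mathbf{e}}\mathbf{e}$ with all $c_{\mathbf{e}}>0$ over oriented edges with distinct underlying edges; $\mathrm{supp}(\alpha)$ is the subgraph formed by these underlying edges and their endpoints; $\alpha$ is connected if $\mathrm{supp}(\alpha)$ is connected. -}

module Defs where

open import Data.Nat as ℕ using (ℕ; zero; suc)
open import Data.Integer as ℤ using (ℤ; ∣_∣)
open import Data.Fin using (Fin; zero; suc)
open import Data.Fin.Properties using (_≟_)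
open import Data.Bool using (Bool; true; false; not)
open import Data.Product using (Σ; ∃; _×_; _,_; proj₁)
open import Data.Sum using (_⊎_)
open import Data.List using (List; []; _∷_; length)
open import Data.Unit using (⊤)
open import Data.Empty using (⊥)
open import Relation.Nullary using (¬_; yes; no)
open import Relation.Binary.PropositionalEquality using (_≡_; _≢_)

sumℤ : (n : ℕ) → (Fin n → ℤ) → ℤ
sumℤ zero    f = ℤ.0ℤ
sumℤ (suc n) f = f zero ℤ.+ sumℤ n (λ i → f (suc i))

sumℕ : (n : ℕ) → (Fin n → ℕ) → ℕ
sumℕ zero    f = 0
sumℕ (suc n) f = f zero ℕ.+ sumℕ n (λ i → f (suc i))

-- A finite graph (loops and multiple edges allowed) with a fixed
-- orientation 𝔬: edge e is oriented as src e → tgt e.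
-- No isolated vertices.
record Graph : Set where
  field
    nV nE : ℕ
    src tgt : Fin nE → Fin nV
    noIsolated : (v : Fin nV) → ∃ λ (e : Fin nE) → (src e ≡ v) ⊎ (tgt e ≡ v)

module _ (G : Graph) where
  open Graph G

  Vertex : Set
  Vertex = Fin nV

  -- Oriented edges: (e , true) is the chosen orientation 𝐞 ∈ 𝐄_𝔬(G),
  -- (e , false) is 𝐞⁻¹.
  OEdge : Set
  OEdge = Fin nE × Bool

  inv : OEdge → OEdge
  inv (e , b) = (e , not b)

  start : OEdge → Vertex
  start (e , true)  = src e
  start (e , false) = tgt e

  end : OEdge → Vertex
  end (e , true)  = tgt e
  end (e , false) = src e

  -- C₁(G,ℤ): chains Σ c_𝐞 𝐞 over 𝐄_𝔬(G), as coefficient functions.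
  Chain : Set
  Chain = Fin nE → ℤ

  degE : Chain → OEdge → ℤ
  degE α (e , true)  = α e
  degE α (e , false) = ℤ.- α e

  degAt : Chain → Vertex → OEdge → ℤ
  degAt α v a with start a ≟ v
  ... | yes _ = degE α a
  ... | no  _ = ℤ.0ℤ

  degV : Chain → Vertex → ℤ
  degV α v = sumℤ nE (λ e → degAt α v (e , true) ℤ.+ degAt α v (e , false))

  InH1 : Chain → Set
  InH1 α = (v : Vertex) → degV α v ≡ ℤ.0ℤ

  NonZero : Chain → Set
  NonZero α = ¬ ((e : Fin nE) → α e ≡ ℤ.0ℤ)

  norm : Chain → ℕ
  norm α = sumℕ nE (λ e → ∣ α e ∣)

  -- the element 𝐚 of C₁(G,ℤ) (with 𝐞⁻¹ = -𝐞)
  oedgeChain : OEdge → Chain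
  oedgeChain (e , b) f with e ≟ f
  ... | yes _ = degE (λ _ → ℤ.1ℤ) (e , b)
  ... | no  _ = ℤ.0ℤ

  zeroChain : Chain
  zeroChain _ = ℤ.0ℤ

  _+C_ : Chain → Chain → Chain
  (α +C β) f = α f ℤ.+ β f

  abel : List OEdge → Chain
  abel []       = zeroChain
  abel (a ∷ as) = oedgeChain a +C abel as

  IsWalk : List OEdge → Set
  IsWalk []            = ⊤
  IsWalk (a ∷ [])      = ⊤
  IsWalk (a ∷ b ∷ as)  = end a ≡ start b × IsWalk (b ∷ as)

  NoBacktrack : List OEdge → Set
  NoBacktrack []           = ⊤
  NoBacktrack (a ∷ [])     = ⊤
  NoBacktrack (a ∷ b ∷ as) = b ≢ inv a × NoBacktrack (b ∷ as)

  lastOf : OEdge → List OEdge → OEdge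
  lastOf a []       = a
  lastOf a (b ∷ as) = lastOf b as

  IsCircuit : List OEdge → Set
  IsCircuit []       = ⊥
  IsCircuit (a ∷ as) =
    IsWalk (a ∷ as) × NoBacktrack (a ∷ as)
    × end (lastOf a as) ≡ start a
    × a ≢ inv (lastOf a as)

  InCircuitSet : Chain → ℕ → List OEdge → Set
  InCircuitSet α l w =
    IsCircuit w × length w ≡ l × ((f : Fin nE) → abel w f ≡ α f)

  SuppEdge : Chain → Fin nE → Set
  SuppEdge α e = α e ≢ ℤ.0ℤ

  SuppVertex : Chain → Vertex → Set
  SuppVertex α v = ∃ λ e → SuppEdge α e × ((src e ≡ v) ⊎ (tgt e ≡ v))

  data SuppWalk (α : Chain) : Vertex → Vertex → Set where
    nil  : ∀ {v} → SuppWalk α v v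
    cons : ∀ {w} (a : OEdge) → SuppEdge α (proj₁ a) →
           SuppWalk α (end a) w → SuppWalk α (start a) w

  Connected : Chain → Set
  Connected α = (u v : Vertex) → SuppVertex α u → SuppVertex α v → SuppWalk α u v

-- A circuit w of length ‖α‖ with abelianization α has |α_e| ≤ (number of
-- occurrences of e in w), and summing over e forces equality everywhere: w runs
-- only through edges of supp(α) and, being closed, connects all of its vertices.
--
-- Conversely, give every edge e of supp(α) multiplicity |α_e| and orient it by
-- the sign of α_e. Since α ∈ H₁ this multigraph is balanced, so Hierholzer's
-- algorithm runs on it: an open trail can always be extended at its start, and
-- a closed trail can be rotated to start at any remaining edge that touches it.
-- When neither move applies, balance shows that nothing remains at the vertices
-- of the trail, so support edges never leave it, and connectivity shows that
-- nothing remains at all. A walk that only follows edges in the direction of α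
-- never backtracks, so the resulting tour is a circuit of length ‖α‖.
module Submission where

open import Defs
open import Data.Bool using (true; false)
open import Data.Empty using (⊥-elim)
open import Data.Fin using (Fin; zero; suc)
open import Data.Fin.Properties using (_≟_; any?; ¬∀⟶∃¬; suc-injective)
open import Data.Integer as ℤ using (ℤ; +_; ∣_∣; 0ℤ; 1ℤ; +≤+; +<+; -<+)
import Data.Integer.Properties as ℤ
open import Data.Integer.Tactic.RingSolver using (solve-∀)
open import Data.List using (List; []; _∷_; length; _++_)
open import Data.List.Properties using (length-++)
open import Data.List.Membership.Propositional using (_∈_)
open import Data.List.Relation.Unary.All as All using (All; []; _∷_)
open import Data.List.Relation.Unary.All.Properties using (++⁺; ++⁻ˡ; ++⁻ʳ)
open import Data.List.Relation.Unary.Any using (here; there)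
open import Data.Nat as ℕ using (ℕ; zero; suc; z≤n)
import Data.Nat.Properties as ℕ
open import Data.Product using (Σ; ∃; _×_; _,_; proj₁; proj₂)
open import Data.Sum using (_⊎_; inj₁; inj₂; [_,_]′)
open import Data.Unit using (tt)
open import Function using (_∘_)
open import Function.Bundles using (_⇔_; mk⇔)
open import Relation.Binary using (tri<; tri≈; tri>)
open import Relation.Binary.PropositionalEquality
open import Relation.Nullary using (¬_; yes; no; Dec)
open import Relation.Nullary.Decidable using (map′; _×-dec_; _⊎-dec_)

i+j<0⇒i<0⊎j<0 : ∀ i j → i ℤ.+ j ℤ.< 0ℤ → i ℤ.< 0ℤ ⊎ j ℤ.< 0ℤ
i+j<0⇒i<0⊎j<0 i j i+j<0 with i ℤ.<? 0ℤ | j ℤ.<? 0ℤ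
... | yes i<0 | _       = inj₁ i<0
... | no _    | yes j<0 = inj₂ j<0
... | no i≮0  | no j≮0  =
  ⊥-elim (ℤ.<⇒≱ i+j<0 (ℤ.+-mono-≤ (ℤ.≮⇒≥ i≮0) (ℤ.≮⇒≥ j≮0)))

i+j≡0⇒i≡0×j≡0 : ∀ {i j} → 0ℤ ℤ.≤ i → 0ℤ ℤ.≤ j → i ℤ.+ j ≡ 0ℤ →
                i ≡ 0ℤ × j ≡ 0ℤ
i+j≡0⇒i≡0×j≡0 (+≤+ {n = m} _) (+≤+ _) i+j≡0 =
  let m+n≡0 = ℤ.+-injective i+j≡0
  in cong +_ (ℕ.m+n≡0⇒m≡0 m m+n≡0) , cong +_ (ℕ.m+n≡0⇒n≡0 m m+n≡0)

suc∣i-1∣≡∣i∣ : ∀ {i} → 0ℤ ℤ.< i → suc ∣ i ℤ.- 1ℤ ∣ ≡ ∣ i ∣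
suc∣i-1∣≡∣i∣ {+ zero}  (+<+ ())
suc∣i-1∣≡∣i∣ {+ suc _} _ = refl

0<i⇒-[i-1]≤0 : ∀ {i} → 0ℤ ℤ.< i → ℤ.- (i ℤ.- 1ℤ) ℤ.≤ 0ℤ
0<i⇒-[i-1]≤0 {+ zero}  (+<+ ())
0<i⇒-[i-1]≤0 {+ suc _} _ = ℤ.neg-mono-≤ (+≤+ z≤n)

sumℕ-cong : ∀ n {f g : Fin n → ℕ} → f ≗ g → sumℕ n f ≡ sumℕ n g
sumℕ-cong zero    f≗g = refl
sumℕ-cong (suc n) f≗g = cong₂ ℕ._+_ (f≗g zero) (sumℕ-cong n (f≗g ∘ suc))

sumℕ-zero : ∀ n {f : Fin n → ℕ} → (∀ i → f i ≡ 0) → sumℕ n f ≡ 0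
sumℕ-zero zero    f≡0 = refl
sumℕ-zero (suc n) f≡0 = cong₂ ℕ._+_ (f≡0 zero) (sumℕ-zero n (f≡0 ∘ suc))

sumℕ-mono-≤ : ∀ n {f g : Fin n → ℕ} → (∀ i → f i ℕ.≤ g i) → sumℕ n f ℕ.≤ sumℕ n g
sumℕ-mono-≤ zero    f≤g = z≤n
sumℕ-mono-≤ (suc n) f≤g = ℕ.+-mono-≤ (f≤g zero) (sumℕ-mono-≤ n (f≤g ∘ suc))

sumℕ-mono-< : ∀ n {f g : Fin n → ℕ} → (∀ i → f i ℕ.≤ g i) → ∀ k → f k ℕ.< g k →
              sumℕ n f ℕ.< sumℕ n g
sumℕ-mono-< (suc n) f≤g zero    fk<gk = ℕ.+-mono-<-≤ fk<gk (sumℕ-mono-≤ n (f≤g ∘ suc))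
sumℕ-mono-< (suc n) f≤g (suc k) fk<gk = ℕ.+-mono-≤-< (f≤g zero) (sumℕ-mono-< n (f≤g ∘ suc) k fk<gk)

sumℕ-suc-at : ∀ n {f g : Fin n → ℕ} k → (∀ i → i ≢ k → f i ≡ g i) → suc (f k) ≡ g k →
              suc (sumℕ n f) ≡ sumℕ n g
sumℕ-suc-at (suc n) zero f≡g sfk≡gk = cong₂ ℕ._+_ sfk≡gk (sumℕ-cong n (λ i → f≡g (suc i) λ ()))
sumℕ-suc-at (suc n) {f} (suc k) f≡g sfk≡gk =
  trans (sym (ℕ.+-suc (f zero) _))
        (cong₂ ℕ._+_ (f≡g zero λ ())
                     (sumℕ-suc-at n k (λ i i≢k → f≡g (suc i) (i≢k ∘ suc-injective)) sfk≡gk))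

sumℤ-cong : ∀ n {f g : Fin n → ℤ} → f ≗ g → sumℤ n f ≡ sumℤ n g
sumℤ-cong zero    f≗g = refl
sumℤ-cong (suc n) f≗g = cong₂ ℤ._+_ (f≗g zero) (sumℤ-cong n (f≗g ∘ suc))

sumℤ-zero : ∀ n {f : Fin n → ℤ} → (∀ i → f i ≡ 0ℤ) → sumℤ n f ≡ 0ℤ
sumℤ-zero zero    f≡0 = refl
sumℤ-zero (suc n) f≡0 = cong₂ ℤ._+_ (f≡0 zero) (sumℤ-zero n (f≡0 ∘ suc))

sumℤ-single : ∀ n {f : Fin n → ℤ} k → (∀ i → i ≢ k → f i ≡ 0ℤ) → sumℤ n f ≡ f k
sumℤ-single (suc n) {f} zero f≡0 =
  trans (cong (ℤ._+_ (f zero)) (sumℤ-zero n (λ i → f≡0 (suc i) λ ()))) (ℤ.+-identityʳ (f zero))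
sumℤ-single (suc n) (suc k) f≡0 =
  trans (cong₂ ℤ._+_ (f≡0 zero λ ())
                     (sumℤ-single n k (λ i i≢k → f≡0 (suc i) (i≢k ∘ suc-injective))))
        (ℤ.+-identityˡ _)

sumℤ-sub : ∀ n (f g : Fin n → ℤ) → sumℤ n (λ i → f i ℤ.- g i) ≡ sumℤ n f ℤ.- sumℤ n g
sumℤ-sub zero    f g = refl
sumℤ-sub (suc n) f g =
  trans (cong (ℤ._+_ (f zero ℤ.- g zero)) (sumℤ-sub n (f ∘ suc) (g ∘ suc)))
        (interchange (f zero) (g zero) (sumℤ n (f ∘ suc)) (sumℤ n (g ∘ suc)))
  where
  interchange : ∀ a b c d → (a ℤ.- b) ℤ.+ (c ℤ.- d) ≡ (a ℤ.+ c) ℤ.- (b ℤ.+ d)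
  interchange = solve-∀

sumℤ-nonneg : ∀ n {f : Fin n → ℤ} → (∀ i → 0ℤ ℤ.≤ f i) → 0ℤ ℤ.≤ sumℤ n f
sumℤ-nonneg zero    f≥0 = ℤ.≤-refl
sumℤ-nonneg (suc n) f≥0 = ℤ.+-mono-≤ (f≥0 zero) (sumℤ-nonneg n (f≥0 ∘ suc))

sumℤ≡0⇒≡0 : ∀ n {f : Fin n → ℤ} → (∀ i → 0ℤ ℤ.≤ f i) → sumℤ n f ≡ 0ℤ →
            ∀ i → f i ≡ 0ℤ
sumℤ≡0⇒≡0 (suc n) f≥0 sum≡0 =
  λ { zero → proj₁ split ; (suc i) → sumℤ≡0⇒≡0 n (f≥0 ∘ suc) (proj₂ split) i }
  where split = i+j≡0⇒i≡0×j≡0 (f≥0 zero) (sumℤ-nonneg n (f≥0 ∘ suc)) sum≡0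

sumℤ<0⇒∃<0 : ∀ n (f : Fin n → ℤ) → sumℤ n f ℤ.< 0ℤ → ∃ λ i → f i ℤ.< 0ℤ
sumℤ<0⇒∃<0 zero    f (+<+ ())
sumℤ<0⇒∃<0 (suc n) f sum<0 with i+j<0⇒i<0⊎j<0 (f zero) _ sum<0
... | inj₁ f0<0    = zero , f0<0
... | inj₂ rest<0 = let i , fi<0 = sumℤ<0⇒∃<0 n (f ∘ suc) rest<0 in suc i , fi<0

module _ (G : Graph) where
  open Graph G

  δ : Vertex G → Vertex G → ℤ
  δ u v with u ≟ v
  ... | yes _ = 1ℤ
  ... | no  _ = 0ℤ

  δ-refl : ∀ v → δ v v ≡ 1ℤ
  δ-refl v with v ≟ v
  ... | yes _   = refl
  ... | no v≢v = ⊥-elim (v≢v refl)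

  δ-≢ : ∀ {u v} → u ≢ v → δ u v ≡ 0ℤ
  δ-≢ {u} {v} u≢v with u ≟ v
  ... | yes u≡v = ⊥-elim (u≢v u≡v)
  ... | no  _   = refl

  _-C_ : Chain G → Chain G → Chain G
  (β -C γ) f = β f ℤ.- γ f

  Positive : Chain G → OEdge G → Set
  Positive γ a = 0ℤ ℤ.< degE G γ a

  Positive? : ∀ γ a → Dec (Positive γ a)
  Positive? γ a = 0ℤ ℤ.<? degE G γ a

  Conforms : Chain G → Chain G → Set
  Conforms β α = ∀ a → Positive β a → Positive α a

  ∃-OEdge? : {P : OEdge G → Set} → (∀ a → Dec (P a)) → Dec (∃ P)
  ∃-OEdge? P? = map′ (λ { (e , inj₁ p) → (e , true) , p ; (e , inj₂ p) → (e , false) , p })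
                     (λ { ((e , true) , p) → e , inj₁ p ; ((e , false) , p) → e , inj₂ p })
                     (any? λ e → P? (e , true) ⊎-dec P? (e , false))

  end-inv : ∀ a → end G (inv G a) ≡ start G a
  end-inv (e , true)  = refl
  end-inv (e , false) = refl

  degE-inv : ∀ γ a → degE G γ (inv G a) ≡ ℤ.- degE G γ a
  degE-inv γ (e , true)  = refl
  degE-inv γ (e , false) = sym (ℤ.neg-involutive (γ e))

  degE-zero : ∀ γ a → γ (proj₁ a) ≡ 0ℤ → degE G γ a ≡ 0ℤ
  degE-zero γ (e , true)  γe≡0 = γe≡0
  degE-zero γ (e , false) γe≡0 = cong ℤ.-_ γe≡0

  ∣degE∣ : ∀ γ a → ∣ degE G γ a ∣ ≡ ∣ γ (proj₁ a) ∣
  ∣degE∣ γ (e , true)  = refl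
  ∣degE∣ γ (e , false) = ℤ.∣-i∣≡∣i∣ (γ e)

  degE≡0⇒≡0 : ∀ γ a → degE G γ a ≡ 0ℤ → γ (proj₁ a) ≡ 0ℤ
  degE≡0⇒≡0 γ a deg≡0 = ℤ.∣i∣≡0⇒i≡0 (trans (sym (∣degE∣ γ a)) (cong ∣_∣ deg≡0))

  degE-sub : ∀ β γ a → degE G (β -C γ) a ≡ degE G β a ℤ.- degE G γ a
  degE-sub β γ (e , true)  = refl
  degE-sub β γ (e , false) = ℤ.neg-distrib-+ (β e) (ℤ.- γ e)

  oedgeChain-diag : ∀ e b → oedgeChain G (e , b) e ≡ degE G (λ _ → 1ℤ) (e , b)
  oedgeChain-diag e b with e ≟ e
  ... | yes _   = refl
  ... | no e≢e = ⊥-elim (e≢e refl)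

  oedgeChain-off : ∀ a {f} → proj₁ a ≢ f → oedgeChain G a f ≡ 0ℤ
  oedgeChain-off (e , b) {f} e≢f with e ≟ f
  ... | yes e≡f = ⊥-elim (e≢f e≡f)
  ... | no  _   = refl

  degE-oedgeChain : ∀ a → degE G (oedgeChain G a) a ≡ 1ℤ
  degE-oedgeChain (e , true)  = oedgeChain-diag e true
  degE-oedgeChain (e , false) = cong ℤ.-_ (oedgeChain-diag e false)

  ∣oedgeChain∣ : ∀ a → ∣ oedgeChain G a (proj₁ a) ∣ ≡ 1
  ∣oedgeChain∣ a = trans (sym (∣degE∣ (oedgeChain G a) a)) (cong ∣_∣ (degE-oedgeChain a))

  degAt-δ : ∀ γ v a → degAt G γ v a ≡ δ (start G a) v ℤ.* degE G γ a
  degAt-δ γ v a with start G a ≟ v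
  ... | yes _ = sym (ℤ.*-identityˡ (degE G γ a))
  ... | no  _ = sym (ℤ.*-zeroˡ (degE G γ a))

  degAt-start : ∀ γ {v} a → start G a ≡ v → degAt G γ v a ≡ degE G γ a
  degAt-start γ {v} a start≡v with start G a ≟ v
  ... | yes _      = refl
  ... | no start≢v = ⊥-elim (start≢v start≡v)

  degAt-zero : ∀ γ v a → γ (proj₁ a) ≡ 0ℤ → degAt G γ v a ≡ 0ℤ
  degAt-zero γ v a γa≡0 with start G a ≟ v
  ... | yes _ = degE-zero γ a γa≡0
  ... | no  _ = refl

  degAt-sub : ∀ β γ v a → degAt G (β -C γ) v a ≡ degAt G β v a ℤ.- degAt G γ v a
  degAt-sub β γ v a with start G a ≟ v
  ... | yes _ = degE-sub β γ a
  ... | no  _ = refl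

  degAt<0 : ∀ γ v a → degAt G γ v a ℤ.< 0ℤ → start G a ≡ v × degE G γ a ℤ.< 0ℤ
  degAt<0 γ v a deg<0 with start G a ≟ v
  ... | yes start≡v = start≡v , deg<0
  ... | no  _    = ⊥-elim (ℤ.<-irrefl refl deg<0)

  degAt-nonneg : ∀ γ v a → (start G a ≡ v → 0ℤ ℤ.≤ degE G γ a) → 0ℤ ℤ.≤ degAt G γ v a
  degAt-nonneg γ v a deg≥0 with start G a ≟ v
  ... | yes start≡v = deg≥0 start≡v
  ... | no  _    = ℤ.≤-refl

  degV-sub : ∀ β γ v → degV G (β -C γ) v ≡ degV G β v ℤ.- degV G γ v
  degV-sub β γ v = trans (sumℤ-cong nE per-edge) (sumℤ-sub nE (pair β) (pair γ))
    where
    pair : Chain G → Fin nE → ℤ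
    pair γ e = degAt G γ v (e , true) ℤ.+ degAt G γ v (e , false)
    interchange : ∀ a b c d → (a ℤ.- b) ℤ.+ (c ℤ.- d) ≡ (a ℤ.+ c) ℤ.- (b ℤ.+ d)
    interchange = solve-∀
    per-edge : ∀ e → pair (β -C γ) e ≡ pair β e ℤ.- pair γ e
    per-edge e = trans (cong₂ ℤ._+_ (degAt-sub β γ v (e , true)) (degAt-sub β γ v (e , false)))
                       (interchange (degAt G β v (e , true)) (degAt G γ v (e , true))
                                    (degAt G β v (e , false)) (degAt G γ v (e , false)))

  degV-oedgeChain : ∀ a v → degV G (oedgeChain G a) v ≡ δ (start G a) v ℤ.- δ (end G a) v
  degV-oedgeChain (e , b) v =
    trans (sumℤ-single nE e elsewhere)
          (trans (cong₂ ℤ._+_ (degAt-δ γ v (e , true)) (degAt-δ γ v (e , false)))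
                 (trans (cong weigh (oedgeChain-diag e b)) (orient b)))
    where
    γ = oedgeChain G (e , b)
    elsewhere : ∀ f → f ≢ e → degAt G γ v (f , true) ℤ.+ degAt G γ v (f , false) ≡ 0ℤ
    elsewhere f f≢e = cong₂ ℤ._+_ (degAt-zero γ v (f , true) γf≡0) (degAt-zero γ v (f , false) γf≡0)
      where γf≡0 = oedgeChain-off (e , b) (f≢e ∘ sym)
    weigh : ℤ → ℤ
    weigh o = δ (src e) v ℤ.* o ℤ.+ δ (tgt e) v ℤ.* ℤ.- o
    forward : ∀ x y → x ℤ.* 1ℤ ℤ.+ y ℤ.* ℤ.- 1ℤ ≡ x ℤ.- y
    forward = solve-∀
    backward : ∀ x y → x ℤ.* ℤ.- 1ℤ ℤ.+ y ℤ.* ℤ.- ℤ.- 1ℤ ≡ y ℤ.- x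
    backward = solve-∀
    orient : ∀ b → weigh (degE G (λ _ → 1ℤ) (e , b)) ≡ δ (start G (e , b)) v ℤ.- δ (end G (e , b)) v
    orient true  = forward (δ (src e) v) (δ (tgt e) v)
    orient false = backward (δ (src e) v) (δ (tgt e) v)

  degV<0⇒inflow : ∀ γ v → degV G γ v ℤ.< 0ℤ → ∃ λ a → Positive γ a × end G a ≡ v
  degV<0⇒inflow γ v deg<0 =
    let e , pair<0 = sumℤ<0⇒∃<0 nE _ deg<0
    in [ reverse (e , true) , reverse (e , false) ]′ (i+j<0⇒i<0⊎j<0 _ _ pair<0)
    where
    reverse : ∀ c → degAt G γ v c ℤ.< 0ℤ → ∃ λ a → Positive γ a × end G a ≡ v
    reverse c degAt<0′ =
      let start≡v , c<0 = degAt<0 γ v c degAt<0′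
      in inv G c , subst (0ℤ ℤ.<_) (sym (degE-inv γ c)) (ℤ.neg-mono-< c<0) , trans (end-inv c) start≡v

  no-inflow⇒vanishes : ∀ γ v → degV G γ v ≡ 0ℤ → (∀ a → end G a ≡ v → ¬ Positive γ a) →
                       ∀ c → start G c ≡ v → γ (proj₁ c) ≡ 0ℤ
  no-inflow⇒vanishes γ v deg≡0 no-inflow (e , b) start≡v =
    degE≡0⇒≡0 γ (e , b) (trans (sym (degAt-start γ (e , b) start≡v)) (at-e b))
    where
    outflow≥0 : ∀ c → start G c ≡ v → 0ℤ ℤ.≤ degE G γ c
    outflow≥0 c start≡v′ = ℤ.neg-cancel-≤ (ℤ.≮⇒≥ λ inv>0 →
      no-inflow (inv G c) (trans (end-inv c) start≡v′) (subst (0ℤ ℤ.<_) (sym (degE-inv γ c)) inv>0))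
    degAt≥0 : ∀ c → 0ℤ ℤ.≤ degAt G γ v c
    degAt≥0 c = degAt-nonneg γ v c (outflow≥0 c)
    both≡0 : degAt G γ v (e , true) ≡ 0ℤ × degAt G γ v (e , false) ≡ 0ℤ
    both≡0 = i+j≡0⇒i≡0×j≡0 (degAt≥0 (e , true)) (degAt≥0 (e , false))
               (sumℤ≡0⇒≡0 nE (λ f → ℤ.+-mono-≤ (degAt≥0 (f , true)) (degAt≥0 (f , false))) deg≡0 e)
    at-e : ∀ b → degAt G γ v (e , b) ≡ 0ℤ
    at-e true  = proj₁ both≡0
    at-e false = proj₂ both≡0

  Positive⇒¬Positive-inv : ∀ γ a → Positive γ a → ¬ Positive γ (inv G a)
  Positive⇒¬Positive-inv γ a a>0 inv>0 =
    ℤ.<-asym a>0 (ℤ.neg-cancel-< (subst (0ℤ ℤ.<_) (degE-inv γ a) inv>0))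

  Positive⇒SuppEdge : ∀ γ a → Positive γ a → SuppEdge G γ (proj₁ a)
  Positive⇒SuppEdge γ a a>0 γa≡0 = ℤ.<-irrefl (sym (degE-zero γ a γa≡0)) a>0

  Positive⇒start∈supp : ∀ γ a → Positive γ a → SuppVertex G γ (start G a)
  Positive⇒start∈supp γ (e , true)  e>0 = e , Positive⇒SuppEdge γ (e , true) e>0 , inj₁ refl
  Positive⇒start∈supp γ (e , false) e>0 = e , Positive⇒SuppEdge γ (e , false) e>0 , inj₂ refl

  conforms-vanish : ∀ {β α} → Conforms β α → ∀ f → α f ≡ 0ℤ → β f ≡ 0ℤ
  conforms-vanish {β} β≼α f αf≡0 with ℤ.<-cmp (β f) 0ℤ
  ... | tri≈ _ βf≡0 _ = βf≡0
  ... | tri< βf<0 _ _ =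
    ⊥-elim (ℤ.<-irrefl (sym (cong ℤ.-_ αf≡0)) (β≼α (f , false) (ℤ.neg-mono-< βf<0)))
  ... | tri> _ _ βf>0 = ⊥-elim (ℤ.<-irrefl (sym αf≡0) (β≼α (f , true) βf>0))

  ¬Positive-inv-remove : ∀ β a → Positive β a → ¬ Positive (β -C oedgeChain G a) (inv G a)
  ¬Positive-inv-remove β a a>0 inv>0 = ℤ.<⇒≱ (subst (0ℤ ℤ.<_) remaining inv>0) (0<i⇒-[i-1]≤0 a>0)
    where
    remaining : degE G (β -C oedgeChain G a) (inv G a) ≡ ℤ.- (degE G β a ℤ.- 1ℤ)
    remaining = trans (degE-inv _ a) (cong ℤ.-_ (trans (degE-sub β _ a)
                                                      (cong (ℤ._-_ (degE G β a)) (degE-oedgeChain a))))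

  Positive-remove : ∀ β a c → Positive β a → Positive (β -C oedgeChain G a) c → Positive β c
  Positive-remove β (e , b) (f , b′) a>0 c>0 with e ≟ f
  ... | no e≢f = subst (0ℤ ℤ.<_) unchanged c>0
    where
    unchanged : degE G (β -C oedgeChain G (e , b)) (f , b′) ≡ degE G β (f , b′)
    unchanged = trans (degE-sub β _ (f , b′))
                      (trans (cong (ℤ._-_ (degE G β (f , b′)))
                                   (degE-zero _ (f , b′) (oedgeChain-off (e , b) e≢f)))
                             (ℤ.+-identityʳ _))
  Positive-remove β (e , true)  (.e , true)  a>0 c>0 | yes refl = a>0
  Positive-remove β (e , false) (.e , false) a>0 c>0 | yes refl = a>0
  Positive-remove β (e , true)  (.e , false) a>0 c>0 | yes refl =
    ⊥-elim (¬Positive-inv-remove β (e , true) a>0 c>0)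
  Positive-remove β (e , false) (.e , true)  a>0 c>0 | yes refl =
    ⊥-elim (¬Positive-inv-remove β (e , false) a>0 c>0)

  norm-remove : ∀ β a → Positive β a → suc (norm G (β -C oedgeChain G a)) ≡ norm G β
  norm-remove β a a>0 = sumℕ-suc-at nE (proj₁ a) unchanged decreased
    where
    unchanged : ∀ f → f ≢ proj₁ a → ∣ (β -C oedgeChain G a) f ∣ ≡ ∣ β f ∣
    unchanged f f≢a =
      cong ∣_∣ (trans (cong (ℤ._-_ (β f)) (oedgeChain-off a (f≢a ∘ sym))) (ℤ.+-identityʳ (β f)))
    decreased : suc ∣ (β -C oedgeChain G a) (proj₁ a) ∣ ≡ ∣ β (proj₁ a) ∣
    decreased = begin
      suc ∣ (β -C oedgeChain G a) (proj₁ a) ∣            ≡⟨ cong suc (sym (∣degE∣ _ a)) ⟩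
      suc ∣ degE G (β -C oedgeChain G a) a ∣             ≡⟨ cong (suc ∘ ∣_∣) (degE-sub β _ a) ⟩
      suc ∣ degE G β a ℤ.- degE G (oedgeChain G a) a ∣  ≡⟨ cong (λ o → suc ∣ degE G β a ℤ.- o ∣)
                                                                (degE-oedgeChain a) ⟩
      suc ∣ degE G β a ℤ.- 1ℤ ∣                          ≡⟨ suc∣i-1∣≡∣i∣ a>0 ⟩
      ∣ degE G β a ∣                                     ≡⟨ ∣degE∣ β a ⟩
      ∣ β (proj₁ a) ∣                                    ∎
      where open ≡-Reasoning

  data Walk : Vertex G → Vertex G → Set where
    []   : ∀ {x} → Walk x x
    cons : ∀ {x y z} a → start G a ≡ x → end G a ≡ y → Walk y z → Walk x z

  edges : ∀ {x z} → Walk x z → List (OEdge G)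
  edges []             = []
  edges (cons a _ _ p) = a ∷ edges p

  _++ʷ_ : ∀ {x y z} → Walk x y → Walk y z → Walk x z
  []             ++ʷ q = q
  cons a s e p ++ʷ q = cons a s e (p ++ʷ q)

  edges-++ʷ : ∀ {x y z} (p : Walk x y) (q : Walk y z) → edges (p ++ʷ q) ≡ edges p ++ edges q
  edges-++ʷ []             q = refl
  edges-++ʷ (cons a s e p) q = cong (a ∷_) (edges-++ʷ p q)

  edges-IsWalk : ∀ {x z} (p : Walk x z) → IsWalk G (edges p)
  edges-IsWalk []                               = tt
  edges-IsWalk (cons a s e [])                  = tt
  edges-IsWalk (cons a s e p@(cons b s′ e′ q)) = trans e (sym s′) , edges-IsWalk p

  end-lastOf : ∀ {y z} a → end G a ≡ y → (q : Walk y z) → end G (lastOf G a (edges q)) ≡ z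
  end-lastOf a e []               = e
  end-lastOf a e (cons b s′ e′ q) = end-lastOf b e′ q

  IsWalk⇒Walk : ∀ {z} a as → IsWalk G (a ∷ as) → end G (lastOf G a as) ≡ z →
                Σ (Walk (start G a) z) λ p → edges p ≡ a ∷ as
  IsWalk⇒Walk a []       _          end≡z = cons a refl end≡z [] , refl
  IsWalk⇒Walk a (b ∷ bs) (end≡start , w) end≡z =
    let p , p≡bs = IsWalk⇒Walk b bs w end≡z in cons a refl end≡start p , cong (a ∷_) p≡bs

  data _∈ᵛ_ (y : Vertex G) : ∀ {x z} → Walk x z → Set where
    here  : ∀ {x z} {p : Walk x z} → y ≡ x → y ∈ᵛ p
    there : ∀ {x w z a s e} {q : Walk w z} → y ∈ᵛ q → y ∈ᵛ cons {x} a s e q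

  _∈ᵛ?_ : ∀ y {x z} (p : Walk x z) → Dec (y ∈ᵛ p)
  _∈ᵛ?_ y {x} []             = map′ here (λ { (here y≡x) → y≡x }) (y ≟ x)
  _∈ᵛ?_ y {x} (cons a s e q) =
    map′ [ here , there ]′ (λ { (here y≡x) → inj₁ y≡x ; (there y∈q) → inj₂ y∈q })
         ((y ≟ x) ⊎-dec (y ∈ᵛ? q))

  ∈ᵛ-split : ∀ {x y z} {p : Walk x z} → y ∈ᵛ p →
             Σ (Walk x y) λ p₁ → Σ (Walk y z) λ p₂ → edges p₁ ++ edges p₂ ≡ edges p
  ∈ᵛ-split {p = p} (here refl) = [] , p , refl
  ∈ᵛ-split (there {a = a} {s} {e} y∈q) =
    let p₁ , p₂ , split = ∈ᵛ-split y∈q in cons a s e p₁ , p₂ , cong (a ∷_) split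

  end-∈ᵛ : ∀ {x z} {p : Walk x z} c → src (proj₁ c) ∈ᵛ p × tgt (proj₁ c) ∈ᵛ p → end G c ∈ᵛ p
  end-∈ᵛ (e , true)  = proj₂
  end-∈ᵛ (e , false) = proj₁

  occurs⇒endpoints-∈ᵛ : ∀ {x z e} (p : Walk x z) → abel G (edges p) e ≢ 0ℤ →
                        src e ∈ᵛ p × tgt e ∈ᵛ p
  occurs⇒endpoints-∈ᵛ []                   abel≢0 = ⊥-elim (abel≢0 refl)
  occurs⇒endpoints-∈ᵛ {e = e} (cons (f , b) s t q) abel≢0 with f ≟ e
  ... | yes refl = endpoints b s t
    where
    endpoints : ∀ b s t → src f ∈ᵛ cons (f , b) s t q × tgt f ∈ᵛ cons (f , b) s t q
    endpoints true  s t = here s , there (here t)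
    endpoints false s t = there (here t) , here s
  ... | no f≢e =
    let src∈ , tgt∈ = occurs⇒endpoints-∈ᵛ q (abel≢0 ∘ trans (ℤ.+-identityˡ _))
    in there src∈ , there tgt∈

  closed-walk-connects : ∀ {P : OEdge G → Set} {x u v} (p : Walk x x) → All P (edges p) →
                         u ∈ᵛ p → v ∈ᵛ p → Σ (Walk u v) λ q → All P (edges q)
  closed-walk-connects {P} p all u∈ v∈ =
    let x→u , u→x , u-split = ∈ᵛ-split u∈
        x→v , v→x , v-split = ∈ᵛ-split v∈
    in u→x ++ʷ x→v ,
       subst (All P) (sym (edges-++ʷ u→x x→v))
             (++⁺ (++⁻ʳ (edges x→u) (subst (All P) (sym u-split) all))
                  (++⁻ˡ (edges x→v) (subst (All P) (sym v-split) all)))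

  toSuppWalk : ∀ α {u v} (q : Walk u v) → All (λ c → SuppEdge G α (proj₁ c)) (edges q) →
               SuppWalk G α u v
  toSuppWalk α []                   []          = nil
  toSuppWalk α (cons a refl refl q) (a∈ ∷ q∈) = cons a a∈ (toSuppWalk α q q∈)

  abel-++ : ∀ l₁ l₂ f → abel G (l₁ ++ l₂) f ≡ abel G l₁ f ℤ.+ abel G l₂ f
  abel-++ []       l₂ f = sym (ℤ.+-identityˡ (abel G l₂ f))
  abel-++ (a ∷ l₁) l₂ f =
    trans (cong (ℤ._+_ (oedgeChain G a f)) (abel-++ l₁ l₂ f))
          (sym (ℤ.+-assoc (oedgeChain G a f) (abel G l₁ f) (abel G l₂ f)))

  abel-++-comm : ∀ l₁ l₂ f → abel G (l₁ ++ l₂) f ≡ abel G (l₂ ++ l₁) f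
  abel-++-comm l₁ l₂ f =
    trans (abel-++ l₁ l₂ f) (trans (ℤ.+-comm (abel G l₁ f) (abel G l₂ f)) (sym (abel-++ l₂ l₁ f)))

  NormCircuit : Chain G → Set
  NormCircuit α = ∃ λ w → InCircuitSet G α (norm G α) w

  count : Fin nE → List (OEdge G) → ℕ
  count f []      = 0
  count f (a ∷ l) = ∣ oedgeChain G a f ∣ ℕ.+ count f l

  sumℕ-count : ∀ l → sumℕ nE (λ f → count f l) ≡ length l
  sumℕ-count []      = sumℕ-zero nE (λ _ → refl)
  sumℕ-count (a ∷ l) =
    trans (sym (sumℕ-suc-at nE (proj₁ a) elsewhere at-a)) (cong suc (sumℕ-count l))
    where
    elsewhere : ∀ f → f ≢ proj₁ a → count f l ≡ count f (a ∷ l)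
    elsewhere f f≢a = sym (cong (λ o → ∣ o ∣ ℕ.+ count f l) (oedgeChain-off a (f≢a ∘ sym)))
    at-a : suc (count (proj₁ a) l) ≡ count (proj₁ a) (a ∷ l)
    at-a = cong (ℕ._+ count (proj₁ a) l) (sym (∣oedgeChain∣ a))

  ∣abel∣≤count : ∀ l f → ∣ abel G l f ∣ ℕ.≤ count f l
  ∣abel∣≤count []      f = z≤n
  ∣abel∣≤count (a ∷ l) f =
    ℕ.≤-trans (ℤ.∣i+j∣≤∣i∣+∣j∣ (oedgeChain G a f) (abel G l f))
              (ℕ.+-monoʳ-≤ _ (∣abel∣≤count l f))

  count-pos : ∀ {c} l → c ∈ l → 0 ℕ.< count (proj₁ c) l
  count-pos {c} (.c ∷ l) (here refl) =
    ℕ.≤-trans (ℕ.≤-reflexive (sym (∣oedgeChain∣ c))) (ℕ.m≤m+n _ _)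
  count-pos     (a ∷ l)  (there c∈l) = ℕ.≤-trans (count-pos l c∈l) (ℕ.m≤n+m _ _)

  length≡norm⇒edges-in-supp : ∀ α l → (∀ f → abel G l f ≡ α f) → length l ≡ norm G α →
                        All (λ c → SuppEdge G α (proj₁ c)) l
  length≡norm⇒edges-in-supp α l abel≡α length≡norm = All.tabulate λ {c} c∈l αc≡0 →
    ℕ.<-irrefl (sym length≡norm) (begin-strict
      norm G α                        ≡⟨ sumℕ-cong nE (λ f → cong ∣_∣ (sym (abel≡α f))) ⟩
      sumℕ nE (λ f → ∣ abel G l f ∣)  <⟨ sumℕ-mono-< nE (∣abel∣≤count l) _ (gap c∈l αc≡0) ⟩
      sumℕ nE (λ f → count f l)       ≡⟨ sumℕ-count l ⟩
      length l                        ∎)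
    where
    open ℕ.≤-Reasoning
    gap : ∀ {c} → c ∈ l → α (proj₁ c) ≡ 0ℤ → ∣ abel G l (proj₁ c) ∣ ℕ.< count (proj₁ c) l
    gap c∈l αc≡0 = subst (ℕ._< count _ l) (sym (cong ∣_∣ (trans (abel≡α _) αc≡0))) (count-pos l c∈l)

  closed-walk⇒connected : ∀ α {x} (p : Walk x x) → All (λ c → SuppEdge G α (proj₁ c)) (edges p) →
                          (∀ f → abel G (edges p) f ≡ α f) → Connected G α
  closed-walk⇒connected α p p⊆supp abel≡α u v u∈supp v∈supp =
    let q , q⊆supp = closed-walk-connects p p⊆supp (on-p u∈supp) (on-p v∈supp)
    in toSuppWalk α q q⊆supp
    where
    endpoints-on-p : ∀ e → SuppEdge G α e → src e ∈ᵛ p × tgt e ∈ᵛ p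
    endpoints-on-p e αe≢0 = occurs⇒endpoints-∈ᵛ p (αe≢0 ∘ trans (sym (abel≡α e)))
    on-p : ∀ {y} → SuppVertex G α y → y ∈ᵛ p
    on-p (e , αe≢0 , inj₁ refl) = proj₁ (endpoints-on-p e αe≢0)
    on-p (e , αe≢0 , inj₂ refl) = proj₂ (endpoints-on-p e αe≢0)

  circuit⇒connected : ∀ α → (NormCircuit α) → Connected G α
  circuit⇒connected α (a ∷ as , (is-walk , _ , closed , _) , length≡norm , abel≡α) =
    let p , edges≡ = IsWalk⇒Walk a as is-walk closed
    in closed-walk⇒connected α p
         (subst (All _) (sym edges≡) (length≡norm⇒edges-in-supp α (a ∷ as) abel≡α length≡norm))
         (λ f → trans (cong (λ l → abel G l f) edges≡) (abel≡α f))

  All-lastOf : ∀ {P : OEdge G → Set} a l → All P (a ∷ l) → P (lastOf G a l)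
  All-lastOf a []      (pa ∷ _)  = pa
  All-lastOf a (b ∷ l) (_ ∷ pbl) = All-lastOf b l pbl

  Positive⇒NoBacktrack : ∀ γ l → All (Positive γ) l → NoBacktrack G l
  Positive⇒NoBacktrack γ []          _                  = tt
  Positive⇒NoBacktrack γ (a ∷ [])    _                  = tt
  Positive⇒NoBacktrack γ (a ∷ b ∷ l) (a>0 ∷ pbl@(b>0 ∷ _)) =
    (λ b≡a⁻¹ → Positive⇒¬Positive-inv γ a a>0 (subst (Positive γ) b≡a⁻¹ b>0)) ,
    Positive⇒NoBacktrack γ (b ∷ l) pbl

  closed-positive-walk⇒circuit : ∀ γ {x y} a (s : start G a ≡ x) (e : end G a ≡ y) (q : Walk y x) →
                                 All (Positive γ) (a ∷ edges q) → IsCircuit G (a ∷ edges q)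
  closed-positive-walk⇒circuit γ a s e q all@(a>0 ∷ _) =
    edges-IsWalk (cons a s e q) , Positive⇒NoBacktrack γ _ all , trans (end-lastOf a e q) (sym s) ,
    λ a≡last⁻¹ → Positive⇒¬Positive-inv γ (lastOf G a (edges q)) (All-lastOf a (edges q) all)
                                         (subst (Positive γ) a≡last⁻¹ a>0)

  Euler-tour⇒circuit : ∀ {α x} → NonZero G α → (p : Walk x x) → All (Positive α) (edges p) →
                       (∀ f → abel G (edges p) f ≡ α f) → length (edges p) ≡ norm G α →
                       NormCircuit α
  Euler-tour⇒circuit     α≢0 []             _   abel≡α _           = ⊥-elim (α≢0 (sym ∘ abel≡α))
  Euler-tour⇒circuit {α} α≢0 (cons a s e q) all abel≡α length≡norm =
    a ∷ edges q , closed-positive-walk⇒circuit α a s e q all , length≡norm , abel≡α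

  -- The state of Hierholzer's algorithm: walk has used up part of α, in the
  -- direction of α, and rest is what is left. As degV counts outflow, rest is a
  -- chain "from z to x".
  record Trail (α : Chain G) (x z : Vertex G) : Set where
    field
      walk          : Walk x z
      rest          : Chain G
      decomposes    : ∀ f → α f ≡ abel G (edges walk) f ℤ.+ rest f
      degV-rest     : ∀ v → degV G rest v ≡ δ z v ℤ.- δ x v
      walk-positive : All (Positive α) (edges walk)
      rest-conforms : Conforms rest α
      length+norm   : length (edges walk) ℕ.+ norm G rest ≡ norm G α
  open Trail

  empty-trail : ∀ {α} x → InH1 G α → Trail α x x
  empty-trail {α} x α∈H₁ = record
    { walk          = []
    ; rest          = α
    ; decomposes    = λ f → sym (ℤ.+-identityˡ (α f))
    ; degV-rest     = λ v → trans (α∈H₁ v) (sym (ℤ.+-inverseʳ (δ x v)))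
    ; walk-positive = []
    ; rest-conforms = λ _ a>0 → a>0
    ; length+norm   = refl
    }

  extend : ∀ {α x z} (t : Trail α x z) a → Positive (rest t) a → end G a ≡ x → Trail α (start G a) z
  extend {α} {x} {z} t a a>0 end≡x = record
    { walk          = cons a refl end≡x (walk t)
    ; rest          = rest t -C oedgeChain G a
    ; decomposes    = λ f → trans (decomposes t f)
                                  (shift (abel G (edges (walk t)) f) (rest t f) (oedgeChain G a f))
    ; degV-rest     = degV-rest′
    ; walk-positive = rest-conforms t a a>0 ∷ walk-positive t
    ; rest-conforms = λ c c>0 → rest-conforms t c (Positive-remove (rest t) a c a>0 c>0)
    ; length+norm   = trans (sym (ℕ.+-suc _ _))
                            (trans (cong (length (edges (walk t)) ℕ.+_) (norm-remove (rest t) a a>0))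
                                   (length+norm t))
    }
    where
    shift : ∀ w r o → w ℤ.+ r ≡ (o ℤ.+ w) ℤ.+ (r ℤ.- o)
    shift = solve-∀
    cancel : ∀ z x s → (z ℤ.- x) ℤ.- (s ℤ.- x) ≡ z ℤ.- s
    cancel = solve-∀
    degV-rest′ : ∀ v → degV G (rest t -C oedgeChain G a) v ≡ δ z v ℤ.- δ (start G a) v
    degV-rest′ v = begin
      degV G (rest t -C oedgeChain G a) v
        ≡⟨ degV-sub (rest t) (oedgeChain G a) v ⟩
      degV G (rest t) v ℤ.- degV G (oedgeChain G a) v
        ≡⟨ cong₂ ℤ._-_ (degV-rest t v) (degV-oedgeChain a v) ⟩
      (δ z v ℤ.- δ x v) ℤ.- (δ (start G a) v ℤ.- δ (end G a) v)
        ≡⟨ cong (λ y → (δ z v ℤ.- δ x v) ℤ.- (δ (start G a) v ℤ.- δ y v)) end≡x ⟩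
      (δ z v ℤ.- δ x v) ℤ.- (δ (start G a) v ℤ.- δ x v)
        ≡⟨ cancel (δ z v) (δ x v) (δ (start G a) v) ⟩
      δ z v ℤ.- δ (start G a) v ∎
      where open ≡-Reasoning

  rotate : ∀ {α x y} (t : Trail α x x) (p₁ : Walk x y) (p₂ : Walk y x) →
           edges p₁ ++ edges p₂ ≡ edges (walk t) → Trail α y y
  rotate {α} {x} {y} t p₁ p₂ split = record
    { walk          = p₂ ++ʷ p₁
    ; rest          = rest t
    ; decomposes    = λ f → trans (decomposes t f) (cong (ℤ._+ rest t f) (sym (abel-rotated f)))
    ; degV-rest     = λ v → trans (degV-rest t v)
                                  (trans (ℤ.+-inverseʳ (δ x v)) (sym (ℤ.+-inverseʳ (δ y v))))
    ; walk-positive = subst (All (Positive α)) (sym (edges-++ʷ p₂ p₁))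
                            (++⁺ (++⁻ʳ (edges p₁) positive) (++⁻ˡ (edges p₁) positive))
    ; rest-conforms = rest-conforms t
    ; length+norm   = trans (cong (ℕ._+ norm G (rest t)) length-rotated) (length+norm t)
    }
    where
    positive : All (Positive α) (edges p₁ ++ edges p₂)
    positive = subst (All (Positive α)) (sym split) (walk-positive t)
    abel-rotated : ∀ f → abel G (edges (p₂ ++ʷ p₁)) f ≡ abel G (edges (walk t)) f
    abel-rotated f = trans (cong (λ l → abel G l f) (edges-++ʷ p₂ p₁))
                           (trans (abel-++-comm (edges p₂) (edges p₁) f) (cong (λ l → abel G l f) split))
    length-rotated : length (edges (p₂ ++ʷ p₁)) ≡ length (edges (walk t))
    length-rotated = begin
      length (edges (p₂ ++ʷ p₁))               ≡⟨ cong length (edges-++ʷ p₂ p₁) ⟩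
      length (edges p₂ ++ edges p₁)            ≡⟨ length-++ (edges p₂) ⟩
      length (edges p₂) ℕ.+ length (edges p₁)  ≡⟨ ℕ.+-comm (length (edges p₂)) _ ⟩
      length (edges p₁) ℕ.+ length (edges p₂)  ≡⟨ sym (length-++ (edges p₁)) ⟩
      length (edges p₁ ++ edges p₂)            ≡⟨ cong length split ⟩
      length (edges (walk t))                  ∎
      where open ≡-Reasoning

  open-trail-inflow : ∀ {α x z} (t : Trail α x z) → x ≢ z → ∃ λ a → Positive (rest t) a × end G a ≡ x
  open-trail-inflow {x = x} t x≢z = degV<0⇒inflow (rest t) x (subst (ℤ._< 0ℤ) (sym degV≡-1) -<+)
    where
    degV≡-1 : degV G (rest t) x ≡ 0ℤ ℤ.- 1ℤ
    degV≡-1 = trans (degV-rest t x) (cong₂ ℤ._-_ (δ-≢ (x≢z ∘ sym)) (δ-refl x))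

  -- Nothing that is left can be attached at a vertex of the walk, so by balance
  -- nothing is left around those vertices either; hence edges of supp(α) never
  -- leave the walk, and by connectivity the walk meets all of supp(α).
  closed-trail-exhausted : ∀ {α x} (t : Trail α x x) → Connected G α → SuppVertex G α x →
                           (∀ a → end G a ∈ᵛ walk t → ¬ Positive (rest t) a) → ∀ f → rest t f ≡ 0ℤ
  closed-trail-exhausted {α} {x} t connected x∈supp stuck f with α f ℤ.≟ 0ℤ
  ... | yes αf≡0 = conforms-vanish (rest-conforms t) f αf≡0
  ... | no  αf≢0 =
    vanishes-on-walk (reach (here refl) (connected x (src f) x∈supp (f , αf≢0 , inj₁ refl))) (f , true) refl
    where
    vanishes-on-walk : ∀ {u} → u ∈ᵛ walk t → ∀ c → start G c ≡ u → rest t (proj₁ c) ≡ 0ℤ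
    vanishes-on-walk {u} u∈ =
      no-inflow⇒vanishes (rest t) u (trans (degV-rest t u) (ℤ.+-inverseʳ (δ x u)))
                         (λ a end≡u → stuck a (subst (_∈ᵛ walk t) (sym end≡u) u∈))
    supp-stays-on-walk : ∀ c → SuppEdge G α (proj₁ c) → start G c ∈ᵛ walk t → end G c ∈ᵛ walk t
    supp-stays-on-walk c c∈supp start∈ = end-∈ᵛ c (occurs⇒endpoints-∈ᵛ (walk t) λ abel≡0 →
      c∈supp (trans (decomposes t (proj₁ c)) (cong₂ ℤ._+_ abel≡0 (vanishes-on-walk start∈ c refl))))
    reach : ∀ {u v} → u ∈ᵛ walk t → SuppWalk G α u v → v ∈ᵛ walk t
    reach u∈ nil                  = u∈
    reach u∈ (cons c c∈supp c⋯v) = reach (supp-stays-on-walk c c∈supp u∈) c⋯v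

  finished-trail⇒circuit : ∀ {α x} → NonZero G α → (t : Trail α x x) → (∀ f → rest t f ≡ 0ℤ) →
                           NormCircuit α
  finished-trail⇒circuit {α} α≢0 t rest≡0 =
    Euler-tour⇒circuit α≢0 (walk t) (walk-positive t) abel≡α length≡norm
    where
    abel≡α : ∀ f → abel G (edges (walk t)) f ≡ α f
    abel≡α f = sym (trans (decomposes t f) (trans (cong (ℤ._+_ (abel G (edges (walk t)) f)) (rest≡0 f))
                                                  (ℤ.+-identityʳ _)))
    length≡norm : length (edges (walk t)) ≡ norm G α
    length≡norm = trans (sym (ℕ.+-identityʳ _))
                        (trans (cong (ℕ._+_ _) (sym (sumℕ-zero nE (cong ∣_∣ ∘ rest≡0)))) (length+norm t))

  module Hierholzer {α : Chain G} (α≢0 : NonZero G α) (connected : Connected G α) where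

    tour : ∀ n {x z} (t : Trail α x z) → SuppVertex G α x → norm G (rest t) ≡ n →
           NormCircuit α
    extend-and-tour : ∀ n {x z} (t : Trail α x z) a → Positive (rest t) a → end G a ≡ x →
                      norm G (rest t) ≡ n → NormCircuit α

    tour n {x} {z} t x∈supp ‖rest‖≡n with x ≟ z
    ... | no x≢z =
      let a , a>0 , end≡x = open-trail-inflow t x≢z in extend-and-tour n t a a>0 end≡x ‖rest‖≡n
    ... | yes refl with ∃-OEdge? (λ a → Positive? (rest t) a ×-dec (end G a ∈ᵛ? walk t))
    ...   | yes (a , a>0 , end∈walk) =
      let p₁ , p₂ , split = ∈ᵛ-split end∈walk
      in extend-and-tour n (rotate t p₁ p₂ split) a a>0 refl ‖rest‖≡n
    ...   | no stuck =
      finished-trail⇒circuit α≢0 t (closed-trail-exhausted t connected x∈supp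
                                      λ a end∈walk a>0 → stuck (a , a>0 , end∈walk))

    extend-and-tour zero    t a a>0 _     ‖rest‖≡0 =
      ⊥-elim (ℕ.1+n≢0 (trans (norm-remove (rest t) a a>0) ‖rest‖≡0))
    extend-and-tour (suc n) t a a>0 end≡x ‖rest‖≡1+n =
      tour n (extend t a a>0 end≡x) (Positive⇒start∈supp α a (rest-conforms t a a>0))
           (ℕ.suc-injective (trans (norm-remove (rest t) a a>0) ‖rest‖≡1+n))

  connected⇒circuit : ∀ α → InH1 G α → NonZero G α → Connected G α → NormCircuit α
  connected⇒circuit α α∈H₁ α≢0 connected =
    let e , αe≢0 = ¬∀⟶∃¬ nE (λ e → α e ≡ 0ℤ) (λ e → α e ℤ.≟ 0ℤ) α≢0
    in Hierholzer.tour α≢0 connected (norm G α) (empty-trail (src e) α∈H₁) (e , αe≢0 , inj₁ refl) refl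

theorem3p3 : (G : Graph) (α : Chain G) → InH1 G α → NonZero G α →
    (∃ λ (w : List (OEdge G)) → InCircuitSet G α (norm G α) w) ⇔ Connected G α
theorem3p3 G α α∈H₁ α≢0 = mk⇔ (circuit⇒connected G α) (connected⇒circuit G α α∈H₁ α≢0)
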